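{- Let $G$ be a finite simple graph with at least three vertices. Then $G$ is a $K_2$-amenable graph if and only if $G$ is a zig-zag graph.
   Context: All graphs are finite and simple. For a set $S\subseteq V(G)$, $\langle S\rangle$ denotes the subgraph induced by $S$. We say "$\langle S\rangle$ is a matching" to mean that the induced subgraph $\langle S\rangle$ is 1-regular, i.e. every vertex of $S$ has exactly one neighbor in $S$ (the empty set qualifies). A weak partition of a set $X$ is a collection of pairwise disjoint, possibly empty, subsets whose union is $X$. For an integer $r\ge 2$, a graph $G$ is $K_r$-amenable if there is a weak partition $\{V_0,V_1,\dots,V_r\}$ of $V(G)$ such that: (A) if $x\in V_0$ then $|N(x)\cap V_i|=1$ for every $i\in\{1,\dots,r\}$; (B) $\langle V_i\rangle$ is a matching for every $i\in\{1,\dots,r\}$; (C) $\langle V_1\cup\cdots\cup V_r\rangle$ is a matching. The distance between an edge $e$ and a vertex $v$ is the minimum distance from $v$ to an end vertex of $e$; the distance $d_G(e_1,e_2)$ between edges is the minimum distance between an end vertex of $e_1$ and an end vertex of $e_2$. Let $G$ be a graph on at least three vertices. A set $E'=\{e_1,\dots,e_k\}\subseteq E(G)$ with $e_i=u_iv_i$ is a zig-zag set of $G$ if: (i) $N(u_i)\cap N(v_i)=\emptyset$ for every $i$; (ii) $d_G(e_i,e_j)\ge 2$ for $1\le i<j\le k$; (iii) for every $x\in V(G)\setminus\{u_i,v_i: i\in[k]\}$ there exist unique $j\ne \ell$ with $d_G(x,e_j)=d_G(x,e_\ell)=1$; (iv) for every sequence $e_{i_1},\dots,e_{i_j}$ of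 distinct edges of $E'$ with $j>2$ and $d_G(e_{i_\ell},e_{i_{\ell+1 \bmod j}})=2$ for all $\ell\in\{1,\dots,j\}$, the number $j$ is even. $G$ is a zig-zag graph if it has a zig-zag set. -}

module Defs where

open import Data.Nat using (ℕ; zero; suc; _<_; _≤_; _<?_; s≤s)
open import Data.Nat.Divisibility using (_∣_)
open import Data.Fin using (Fin; zero; suc; toℕ; fromℕ<)
open import Data.Bool using (Bool; true; false)
open import Data.Product using (Σ; Σ-syntax; _×_; _,_)
open import Data.Sum using (_⊎_)
open import Relation.Nullary using (¬_; yes; no)
open import Relation.Binary.PropositionalEquality using (_≡_; _≢_)
open import Function.Definitions using (Injective)

record SimpleGraph (n : ℕ) : Set where
  field
    adj    : Fin n → Fin n → Bool
    sym    : ∀ x y → adj x y ≡ adj y x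
    irrefl : ∀ x → adj x x ≡ false

ExactlyOne : {n : ℕ} → (Fin n → Set) → Set
ExactlyOne {n} P = Σ[ y ∈ Fin n ] (P y × (∀ z → P z → z ≡ y))

next : {m : ℕ} → Fin (suc m) → Fin (suc m)
next {m} i with suc (toℕ i) <? suc m
... | yes p = fromℕ< p
... | no _  = zero

module _ {n : ℕ} (G : SimpleGraph n) where
  open SimpleGraph G

  Adj : Fin n → Fin n → Set
  Adj x y = adj x y ≡ true

  data Walk : Fin n → Fin n → ℕ → Set where
    nil  : ∀ {x} → Walk x x 0
    cons : ∀ {x y z k} → Adj x y → Walk y z k → Walk x z (suc k)

  SetDist : (Fin n → Set) → (Fin n → Set) → ℕ → Set
  SetDist A B d =
    (Σ[ a ∈ Fin n ] Σ[ b ∈ Fin n ] (A a × B b × Walk a b d)) ×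
    (∀ m → m < d → ∀ a b → A a → B b → ¬ Walk a b m)

  SetDist≥ : (Fin n → Set) → (Fin n → Set) → ℕ → Set
  SetDist≥ A B d = ∀ m → m < d → ∀ a b → A a → B b → ¬ Walk a b m

  Edge : Set
  Edge = Σ[ u ∈ Fin n ] Σ[ v ∈ Fin n ] Adj u v

  Ends : Edge → Fin n → Set
  Ends (u , v , _) w = (w ≡ u) ⊎ (w ≡ v)

  Single : Fin n → Fin n → Set
  Single x w = w ≡ x

  -- K_r-amenability.  The weak partition {V_0,…,V_r} is encoded by the
  -- function part : Fin n → Fin (suc r), with V_i = part ⁻¹(i).
  IsKrPartition : (r : ℕ) → (Fin n → Fin (suc r)) → Set
  IsKrPartition r part =
    (∀ x → part x ≡ zero → ∀ (i : Fin r) →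
       ExactlyOne (λ y → Adj x y × part y ≡ suc i)) ×
    (∀ (i : Fin r) → ∀ x → part x ≡ suc i →
       ExactlyOne (λ y → Adj x y × part y ≡ suc i)) ×
    (∀ x → part x ≢ zero → ExactlyOne (λ y → Adj x y × part y ≢ zero))

  Amenable : ℕ → Set
  Amenable r = Σ[ part ∈ (Fin n → Fin (suc r)) ] IsKrPartition r part

  IsZigZagSet : (k : ℕ) → (Fin k → Edge) → Set
  IsZigZagSet k e =
    (∀ i → let (u , v , _) = e i in ∀ w → ¬ (Adj u w × Adj v w)) ×
    (∀ i j → toℕ i < toℕ j → SetDist≥ (Ends (e i)) (Ends (e j)) 2) ×
    (∀ x → (∀ i → ¬ Ends (e i) x) →
       Σ[ j ∈ Fin k ] Σ[ ℓ ∈ Fin k ]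
         (j ≢ ℓ × SetDist (Single x) (Ends (e j)) 1
                × SetDist (Single x) (Ends (e ℓ)) 1
                × (∀ p → SetDist (Single x) (Ends (e p)) 1 →
                     (p ≡ j) ⊎ (p ≡ ℓ)))) ×
    (∀ m (s : Fin (suc m) → Fin k) → 2 < suc m → Injective _≡_ _≡_ s →
       (∀ ℓ → SetDist (Ends (e (s ℓ))) (Ends (e (s (next ℓ)))) 2) →
       2 ∣ suc m)

  IsZigZagGraph : Set
  IsZigZagGraph = Σ[ k ∈ ℕ ] Σ[ e ∈ (Fin k → Edge) ] IsZigZagSet k e

module Submission where

-- (⇒) In a K₂-partition {V₀,V₁,V₂}, condition (C) perfectly matches V₁ ∪ V₂,
-- and by (B) every matching edge lies inside V₁ or inside V₂.  These
-- matching edges form a zig-zag set: (i)–(iii) come from the uniqueness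
-- clauses of (A)–(C), and edges at distance 2 lie in different classes, so
-- the classes properly 2-colour every cycle of (iv), which is hence even.
-- (⇐) Call two edges of a zig-zag set touching if some vertex is adjacent to
-- both.  Touching edges are at distance 2, so by (iv) touching has only even
-- cycles and, by the bipartition theorem, a proper 2-colouring; the ends of
-- each edge go into V₁ or V₂ according to its colour, all else into V₀.

open import Data.Bool using (Bool; true; false; not; _xor_)
open import Data.Bool.Properties
  using (not-involutive; not-distribˡ-xor; not-distribʳ-xor; xor-same; ¬-not)
  renaming (_≟_ to _≟ᴮ_)
open import Data.Empty using (⊥-elim)
open import Data.Fin using (Fin; zero; suc; toℕ; fromℕ<)
open import Data.Fin.Properties
  using (toℕ-injective; toℕ-fromℕ<; toℕ<n; any?; pigeonhole)
  renaming (_≟_ to _≟ᶠ_; 0≢1+n to zero≢suc)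
open import Data.List using (List; filter; lookup; length; allFin)
open import Data.List.Relation.Unary.AllPairs using (_∷_)
open import Data.List.Membership.Propositional using (_∈_)
open import Data.List.Membership.Propositional.Properties
  using (∈-filter⁺; ∈-filter⁻; ∈-lookup; ∈-allFin)
open import Data.List.Relation.Unary.All using () renaming (lookup to lookupAll)
open import Data.List.Relation.Unary.Any using () renaming (index to indexAny)
open import Data.List.Relation.Unary.Any.Properties using (lookup-index)
open import Data.List.Relation.Unary.Unique.Propositional using (Unique)
open import Data.List.Relation.Unary.Unique.Propositional.Properties using (allFin⁺; filter⁺)
open import Data.Nat using (ℕ; zero; suc; _+_; _*_; _≤_; _<_; z≤n; s≤s; _<?_)
open import Data.Nat.Divisibility using (_∣_; divides; ∣-refl; ∣m∣n⇒∣m+n)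
open import Data.Nat.Induction using (<-rec)
open import Data.Nat.Properties
  using (+-comm; +-suc; +-identityʳ; ≤-refl; ≤-antisym; ≤-pred; <⇒≤; <⇒≢; ≮⇒≥;
         <-irrefl; <-asym; <-cmp; m<m+n; m<n+m)
open import Data.Product using (Σ; Σ-syntax; _×_; _,_; proj₁; proj₂)
open import Data.Sum using (_⊎_; inj₁; inj₂; swap)
open import Data.Unit using (⊤; tt)
open import Function using (_∘_)
open import Function.Definitions using (Injective)
open import Relation.Binary.Definitions using (DecidableEquality; tri<; tri≈; tri>)
open import Relation.Binary.PropositionalEquality
open import Relation.Nullary using (¬_; Dec; yes; no; contradiction)
open import Relation.Nullary.Decidable using (_×-dec_; _⊎-dec_; ¬?; isYes)

open import Defs

odd : ℕ → Bool
odd zero    = false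
odd (suc n) = not (odd n)

odd-+ : ∀ m n → odd (m + n) ≡ odd m xor odd n
odd-+ zero    n = refl
odd-+ (suc m) n = trans (cong not (odd-+ m n)) (not-distribˡ-xor (odd m) (odd n))

even⇒2∣ : ∀ n → odd n ≡ false → 2 ∣ n
even⇒2∣ zero          _    = divides 0 refl
even⇒2∣ (suc zero)    ()
even⇒2∣ (suc (suc n)) even =
  ∣m∣n⇒∣m+n (∣-refl {2}) (even⇒2∣ n (trans (sym (not-involutive (odd n))) even))

2∣⇒even : ∀ {n} → 2 ∣ n → odd n ≡ false
2∣⇒even (divides q refl) = odd-double q
  where
  odd-double : ∀ q → odd (q * 2) ≡ false
  odd-double zero    = refl
  odd-double (suc q) = trans (not-involutive _) (odd-double q)

true≢false : true ≢ false
true≢false ()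

xor-not : ∀ x → x xor not x ≡ true
xor-not x = trans (sym (not-distribʳ-xor x x)) (cong not (xor-same x))

xor-fixed : ∀ x b → b ≡ x xor b → x ≡ false
xor-fixed false b _  = refl
xor-fixed true  true  ()
xor-fixed true  false ()

next-spec : ∀ {m} (ℓ : Fin (suc m)) →
  (toℕ (next ℓ) ≡ suc (toℕ ℓ)) ⊎ (toℕ ℓ ≡ m × next ℓ ≡ zero)
next-spec {m} ℓ with suc (toℕ ℓ) <? suc m
... | yes ℓ+1<m+1 = inj₁ (toℕ-fromℕ< ℓ+1<m+1)
... | no  ℓ+1≮m+1 = inj₂ (≤-antisym (≤-pred (toℕ<n ℓ)) (≮⇒≥ (ℓ+1≮m+1 ∘ s≤s)) , refl)

CyclesEven : ∀ {k} → (Fin k → Fin k → Set) → Set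
CyclesEven {k} R =
  ∀ m (s : Fin (suc m) → Fin k) → 2 < suc m → Injective _≡_ _≡_ s →
  (∀ ℓ → R (s ℓ) (s (next ℓ))) → 2 ∣ suc m

-- A cyclic sequence in which consecutive entries get different colours has
-- even length: the colour at position t is (odd t) xor (colour at 0), and
-- going once around returns to position 0.
proper-cycle-even : ∀ m (c : Fin (suc m) → Bool) →
  (∀ ℓ → c ℓ ≢ c (next ℓ)) → 2 ∣ suc m
proper-cycle-even m c proper = even⇒2∣ (suc m) (xor-fixed (odd (suc m)) (c zero) wrap)
  where
  open ≡-Reasoning

  flips : ∀ ℓ → c (next ℓ) ≡ not (c ℓ)
  flips ℓ = ¬-not (proper ℓ ∘ sym)

  pos : ∀ t → t ≤ m → Fin (suc m)
  pos t t≤m = fromℕ< (s≤s t≤m)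

  next-pos : ∀ t (t<m : suc t ≤ m) → next (pos t (<⇒≤ t<m)) ≡ pos (suc t) t<m
  next-pos t t<m with next-spec (pos t (<⇒≤ t<m))
  ... | inj₁ step = toℕ-injective (trans step (trans (cong suc (toℕ-fromℕ< _))
                                                     (sym (toℕ-fromℕ< (s≤s t<m)))))
  ... | inj₂ (t≡m , _) = contradiction (trans (sym (toℕ-fromℕ< _)) t≡m) (<⇒≢ t<m)

  colour-at : ∀ t (t≤m : t ≤ m) → c (pos t t≤m) ≡ odd t xor c zero
  colour-at zero    _   = refl
  colour-at (suc t) t<m = begin
    c (pos (suc t) t<m)           ≡⟨ cong c (sym (next-pos t t<m)) ⟩
    c (next (pos t (<⇒≤ t<m)))    ≡⟨ flips _ ⟩
    not (c (pos t (<⇒≤ t<m)))     ≡⟨ cong not (colour-at t (<⇒≤ t<m)) ⟩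
    not (odd t xor c zero)        ≡⟨ not-distribˡ-xor (odd t) (c zero) ⟩
    odd (suc t) xor c zero        ∎

  last-wraps : next (pos m ≤-refl) ≡ zero
  last-wraps with next-spec (pos m ≤-refl)
  ... | inj₁ step  = contradiction (subst (_< suc m) (trans step (cong suc (toℕ-fromℕ< _)))
                                          (toℕ<n (next (pos m ≤-refl)))) (<-irrefl refl)
  ... | inj₂ (_ , wraps) = wraps

  wrap : c zero ≡ odd (suc m) xor c zero
  wrap = begin
    c zero                  ≡⟨ cong c (sym last-wraps) ⟩
    c (next (pos m ≤-refl)) ≡⟨ flips _ ⟩
    not (c (pos m ≤-refl))  ≡⟨ cong not (colour-at m ≤-refl) ⟩
    not (odd m xor c zero)  ≡⟨ not-distribˡ-xor (odd m) (c zero) ⟩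
    odd (suc m) xor c zero  ∎

module Walks {A : Set} (R : A → A → Set) where

  data RWalk : A → A → ℕ → Set where
    nil  : ∀ {a} → RWalk a a 0
    cons : ∀ {a b c L} → R a b → RWalk b c L → RWalk a c (suc L)

  _++_ : ∀ {a b c L₁ L₂} → RWalk a b L₁ → RWalk b c L₂ → RWalk a c (L₁ + L₂)
  nil      ++ w = w
  cons r p ++ w = cons r (p ++ w)

  reverse : (∀ {x y} → R x y → R y x) → ∀ {a b L} → RWalk a b L → RWalk b a L
  reverse R-sym nil = nil
  reverse R-sym {L = suc L} (cons r w) =
    subst (RWalk _ _) (+-comm L 1) (reverse R-sym w ++ cons (R-sym r) nil)

  -- the vertex reached after t steps (the end vertex once t ≥ L)
  at : ∀ {a b L} → RWalk a b L → ℕ → A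
  at {a} nil          _       = a
  at (cons {a} _ _)   zero    = a
  at (cons _ w)       (suc t) = at w t

  at-0 : ∀ {a b L} (w : RWalk a b L) → at w 0 ≡ a
  at-0 nil        = refl
  at-0 (cons _ _) = refl

  at-end : ∀ {a b L} (w : RWalk a b L) → at w L ≡ b
  at-end nil        = refl
  at-end (cons _ w) = at-end w

  at-step : ∀ {a b L} (w : RWalk a b L) t → t < L → R (at w t) (at w (suc t))
  at-step (cons r w) zero    _       = subst (R _) (sym (at-0 w)) r
  at-step (cons r w) (suc t) (s≤s t<L) = at-step w t t<L

  splitAt : ∀ {a b L} t → t ≤ L → (w : RWalk a b L) →
    Σ ℕ λ L₂ → RWalk a (at w t) t × RWalk (at w t) b L₂ × t + L₂ ≡ L
  splitAt zero    _         nil        = 0 , nil , nil , refl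
  splitAt zero    _         (cons r w) = _ , nil , cons r w , refl
  splitAt (suc t) (s≤s t≤L) (cons r w) with splitAt t t≤L w
  ... | L₂ , front , back , len = L₂ , cons r front , back , cong suc len

  -- the vertices visited before the last step are pairwise distinct
  Distinct : ∀ {a b L} → RWalk a b L → Set
  Distinct {L = L} w = ∀ i j → i < L → j < L → at w i ≡ at w j → i ≡ j

  record Detour (a b : A) (L : ℕ) : Set where
    field
      hub          : A
      loopLength   : ℕ
      restLength   : ℕ
      loop         : RWalk hub hub (suc loopLength)
      rest         : RWalk a b restLength
      lengths      : suc loopLength + restLength ≡ L
      restNonempty : 0 < restLength

    loop-shorter : suc loopLength < L
    loop-shorter = subst (suc loopLength <_) lengths (m<m+n (suc loopLength) restNonempty)

    rest-shorter : restLength < L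
    rest-shorter = subst (restLength <_) lengths (m<n+m restLength (s≤s z≤n))

    odd-length : odd L ≡ odd (suc loopLength) xor odd restLength
    odd-length = trans (cong odd (sym lengths)) (odd-+ (suc loopLength) restLength)

  -- By induction on
  -- the walk: prepending a step to a walk with distinct vertices either
  -- keeps them distinct or closes a loop at the new first vertex.
  decompose : DecidableEquality A → ∀ {a b L} (w : RWalk a b L) → Distinct w ⊎ Detour a b L
  decompose _≟_ nil = inj₁ (λ _ _ ())
  decompose _≟_ {a} (cons r w) with decompose _≟_ w
  ... | inj₂ d = inj₂ record
    { hub = hub ; loopLength = loopLength ; restLength = suc restLength
    ; loop = loop ; rest = cons r rest
    ; lengths = trans (+-suc (suc loopLength) restLength) (cong suc lengths)
    ; restNonempty = s≤s z≤n }
    where open Detour d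
  ... | inj₁ distinct with any? (λ (t : Fin _) → a ≟ at w (toℕ t))
  ...   | yes (t , a≡wₜ) = inj₂ (closeLoop (toℕ t) (toℕ<n t) a≡wₜ)
    where
    closeLoop : ∀ t → t < _ → a ≡ at w t → Detour a _ _
    closeLoop t t<L a≡wₜ with splitAt t (<⇒≤ t<L) w
    ... | L₂ , front , back , len = record
      { hub = a ; loopLength = t ; restLength = L₂
      ; loop = subst (λ x → RWalk a x (suc t)) (sym a≡wₜ) (cons r front)
      ; rest = subst (λ x → RWalk x _ L₂) (sym a≡wₜ) back
      ; lengths = cong suc len
      ; restNonempty = nonempty L₂ len }
      where
      nonempty : ∀ L₂ → t + L₂ ≡ _ → 0 < L₂
      nonempty zero    t+0≡L = contradiction (trans (sym (+-identityʳ t)) t+0≡L) (<⇒≢ t<L)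
      nonempty (suc _) _     = s≤s z≤n
  ...   | no a∉w = inj₁ distinct′
    where
    fresh : ∀ {j} → j < _ → a ≢ at w j
    fresh {j} j<L a≡wⱼ =
      a∉w (fromℕ< j<L , subst (λ i → a ≡ at w i) (sym (toℕ-fromℕ< j<L)) a≡wⱼ)

    distinct′ : Distinct (cons r w)
    distinct′ zero    zero    _         _         _  = refl
    distinct′ zero    (suc j) _         (s≤s j<L) eq = contradiction eq (fresh j<L)
    distinct′ (suc i) zero    (s≤s i<L) _         eq = contradiction (sym eq) (fresh i<L)
    distinct′ (suc i) (suc j) (s≤s i<L) (s≤s j<L) eq = cong suc (distinct i j i<L j<L eq)

-- In an irreflexive relation on a k-element set whose cycles are all even,
-- every closed walk has even length: a closed walk either is a cycle or
-- splits into two shorter closed walks.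
module EvenClosedWalks {k : ℕ} (R : Fin k → Fin k → Set)
  (R-irrefl : ∀ a → ¬ R a a) (cycles : CyclesEven R) where
  open Walks R

  distinct-closed-even : ∀ {a L} (w : RWalk a a L) → Distinct w → odd L ≡ false
  distinct-closed-even {L = 0} _            _ = refl
  distinct-closed-even {L = 1} (cons r nil) _ = ⊥-elim (R-irrefl _ r)
  distinct-closed-even {L = 2} _            _ = refl
  distinct-closed-even {a} {L = suc (suc (suc m))} w distinct =
    2∣⇒even (cycles (suc (suc m)) vertex (s≤s (s≤s (s≤s z≤n))) injective step)
    where
    vertex : Fin (suc (suc (suc m))) → Fin k
    vertex ℓ = at w (toℕ ℓ)

    injective : Injective _≡_ _≡_ vertex
    injective {i} {j} eq = toℕ-injective (distinct _ _ (toℕ<n i) (toℕ<n j) eq)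

    step : ∀ ℓ → R (vertex ℓ) (vertex (next ℓ))
    step ℓ with next-spec ℓ
    ... | inj₁ incremented =
      subst (λ t → R (vertex ℓ) (at w t)) (sym incremented) (at-step w (toℕ ℓ) (toℕ<n ℓ))
    ... | inj₂ (ℓ≡last , wraps) rewrite wraps =
      subst (R (vertex ℓ)) (trans (cong (at w ∘ suc) ℓ≡last) (trans (at-end w) (sym (at-0 w))))
            (at-step w (toℕ ℓ) (toℕ<n ℓ))

  closed-even : ∀ L {a} → RWalk a a L → odd L ≡ false
  closed-even = <-rec (λ L → ∀ {a} → RWalk a a L → odd L ≡ false) step
    where
    step : ∀ L → (∀ {L′} → L′ < L → ∀ {a} → RWalk a a L′ → odd L′ ≡ false) →
           ∀ {a} → RWalk a a L → odd L ≡ false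
    step L shorter-even w with decompose _≟ᶠ_ w
    ... | inj₁ distinct = distinct-closed-even w distinct
    ... | inj₂ detour   = begin
      odd L                                    ≡⟨ odd-length ⟩
      odd (suc loopLength) xor odd restLength  ≡⟨ cong₂ _xor_ (shorter-even loop-shorter loop)
                                                               (shorter-even rest-shorter rest) ⟩
      false                                    ∎
      where
      open Detour detour
      open ≡-Reasoning

  detour-parity : ∀ {a b L} (d : Detour a b L) → odd (Detour.restLength d) ≡ odd L
  detour-parity d = sym (trans odd-length (cong (_xor odd restLength) (closed-even _ loop)))
    where open Detour d

  distinct-short : ∀ {a b L} (w : RWalk a b L) → Distinct w → L ≤ k
  distinct-short {L = L} w distinct with k <? L
  ... | no  k≮L = ≮⇒≥ k≮L
  ... | yes k<L with pigeonhole k<L (λ i → at w (toℕ i))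
  ...   | i , j , i<j , eq = contradiction (distinct _ _ (toℕ<n i) (toℕ<n j) eq) (<⇒≢ i<j)

  Shortened : Fin k → Fin k → ℕ → Set
  Shortened a b L = Σ ℕ λ L′ → L′ ≤ k × odd L′ ≡ odd L × RWalk a b L′

  shorten : ∀ L {a b} → RWalk a b L → Shortened a b L
  shorten = <-rec (λ L → ∀ {a b} → RWalk a b L → Shortened a b L) step
    where
    step : ∀ L → (∀ {L′} → L′ < L → ∀ {a b} → RWalk a b L′ → Shortened a b L′) →
           ∀ {a b} → RWalk a b L → Shortened a b L
    step L shorter w with decompose _≟ᶠ_ w
    ... | inj₁ distinct = L , distinct-short w distinct , refl , w
    ... | inj₂ detour with shorter (Detour.rest-shorter detour) (Detour.rest detour)
    ...   | L′ , L′≤k , parity , w′ = L′ , L′≤k , trans parity (detour-parity detour) , w′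

least : ∀ {n} (P : Fin n → Set) → (∀ i → Dec (P i)) → ∀ {x} → P x →
  Σ (Fin n) λ m → P m × (∀ i → P i → toℕ m ≤ toℕ i)
least {suc n} P P? {x} px with P? zero
... | yes p0 = zero , p0 , λ _ _ → z≤n
least {suc n} P P? {zero}   px | no ¬p0 = contradiction px ¬p0
least {suc n} P P? {suc x′} px | no ¬p0 with least (P ∘ suc) (P? ∘ suc) px
... | m , pm , minimal = suc m , pm , λ { zero p → contradiction p ¬p0
                                        ; (suc i) p → s≤s (minimal i p) }

-- In each connected component pick the least
-- vertex as root and colour a vertex by the parity of a walk from the root;
-- since closed walks are even, this parity does not depend on the walk, and
-- adjacent vertices get different colours.  Walks can be taken of length
-- at most k, which makes reachability decidable.
module Bipartition {k : ℕ} (R : Fin k → Fin k → Set) (R? : ∀ a b → Dec (R a b))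
  (R-sym : ∀ {a b} → R a b → R b a) (R-irrefl : ∀ a → ¬ R a a) (cycles : CyclesEven R) where
  open Walks R
  open EvenClosedWalks R R-irrefl cycles

  walk? : ∀ L a b → Dec (RWalk a b L)
  walk? zero a b with a ≟ᶠ b
  ... | yes refl = yes nil
  ... | no  a≢b  = no λ { nil → a≢b refl }
  walk? (suc L) a b with any? (λ c → R? a c ×-dec walk? L c b)
  ... | yes (c , r , w) = yes (cons r w)
  ... | no  ¬step       = no λ { (cons r w) → ¬step (_ , r , w) }

  BoundedWalk : (ℕ → Set) → Fin k → Fin k → Set
  BoundedWalk Len a b = Σ (Fin (suc k)) λ L → Len (toℕ L) × RWalk a b (toℕ L)

  boundedWalk? : ∀ {Len : ℕ → Set} → (∀ L → Dec (Len L)) → ∀ a b → Dec (BoundedWalk Len a b)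
  boundedWalk? Len? a b = any? (λ L → Len? (toℕ L) ×-dec walk? (toℕ L) a b)

  toBounded : ∀ {a b L} → RWalk a b L → BoundedWalk (λ L′ → odd L′ ≡ odd L) a b
  toBounded {L = L} w with shorten L w
  ... | L′ , L′≤k , parity , w′ =
    fromℕ< (s≤s L′≤k) , subst (λ t → odd t ≡ odd L) (sym toℕ≡L′) parity
                      , subst (RWalk _ _) (sym toℕ≡L′) w′
    where
    toℕ≡L′ : toℕ (fromℕ< (s≤s L′≤k)) ≡ L′
    toℕ≡L′ = toℕ-fromℕ< (s≤s L′≤k)

  Reach : Fin k → Fin k → Set
  Reach = BoundedWalk (λ _ → ⊤)

  reach : ∀ {a b L} → RWalk a b L → Reach a b
  reach w with toBounded w
  ... | L , _ , w′ = L , tt , w′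

  root-least : ∀ a → Σ (Fin k) λ m → Reach a m × (∀ i → Reach a i → toℕ m ≤ toℕ i)
  root-least a = least (Reach a) (boundedWalk? (λ _ → yes tt) a) (reach (nil {a}))

  root : Fin k → Fin k
  root a = proj₁ (root-least a)

  reaches-root : ∀ a → Reach a (root a)
  reaches-root a = proj₁ (proj₂ (root-least a))

  root-minimal : ∀ a i → Reach a i → toℕ (root a) ≤ toℕ i
  root-minimal a = proj₂ (proj₂ (root-least a))

  from-root : ∀ a → Σ ℕ λ L → RWalk (root a) a L
  from-root a with reaches-root a
  ... | L , _ , w = toℕ L , reverse R-sym w

  -- R-related vertices reach the same vertices, hence have the same root
  root-R : ∀ {a b} → R a b → root a ≡ root b
  root-R {a} {b} r = toℕ-injective (≤-antisym
    (root-minimal a (root b) (via r (reaches-root b)))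
    (root-minimal b (root a) (via (R-sym r) (reaches-root a))))
    where
    via : ∀ {a b c} → R a b → Reach b c → Reach a c
    via r (_ , _ , w) = reach (cons r w)

  colour : Fin k → Bool
  colour a = isYes (boundedWalk? (λ L → odd L ≟ᴮ true) (root a) a)

  colour-spec : ∀ a {L} → RWalk (root a) a L → colour a ≡ odd L
  colour-spec a {L} w with boundedWalk? (λ L → odd L ≟ᴮ true) (root a) a | odd L in oddL
  ... | yes _ | true  = refl
  ... | no  _ | false = refl
  ... | yes (L′ , oddL′ , w′) | false =
    contradiction (closed-even _ (w′ ++ reverse R-sym w)) λ even →
      true≢false (begin
        true                       ≡⟨ sym (cong (_xor false) oddL′) ⟩
        odd (toℕ L′) xor false     ≡⟨ cong (odd (toℕ L′) xor_) (sym oddL) ⟩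
        odd (toℕ L′) xor odd L     ≡⟨ sym (odd-+ (toℕ L′) L) ⟩
        odd (toℕ L′ + L)           ≡⟨ even ⟩
        false                      ∎)
    where open ≡-Reasoning
  ... | no ¬short | true with toBounded w
  ...   | L′ , parity , w′ = ⊥-elim (¬short (L′ , trans parity oddL , w′))

  colour-proper : ∀ {a b} → R a b → colour a ≢ colour b
  colour-proper {a} {b} r same with from-root a | from-root b
  ... | La , wa | Lb , wb = true≢false (begin
    true                       ≡⟨ sym (xor-not (odd La)) ⟩
    odd La xor not (odd La)    ≡⟨ cong (λ x → odd La xor not x) parity ⟩
    odd La xor not (odd Lb)    ≡⟨ sym (odd-+ La (suc Lb)) ⟩
    odd (La + suc Lb)          ≡⟨ closed-even _ around ⟩
    false                      ∎)
    where
    open ≡-Reasoning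
    parity : odd La ≡ odd Lb
    parity = trans (sym (colour-spec a wa)) (trans same (colour-spec b wb))
    -- root → a → b → root
    around : RWalk (root a) (root a) (La + suc Lb)
    around = subst (λ x → RWalk (root a) x (La + suc Lb)) (sym (root-R r))
                   (wa ++ cons r (reverse R-sym wb))

bipartite : ∀ {k} (R : Fin k → Fin k → Set) → (∀ a b → Dec (R a b)) →
  (∀ {a b} → R a b → R b a) → (∀ a → ¬ R a a) → CyclesEven R →
  Σ[ colour ∈ (Fin k → Bool) ] (∀ {a b} → R a b → colour a ≢ colour b)
bipartite R R? R-sym R-irrefl cycles = colour , colour-proper
  where open Bipartition R R? R-sym R-irrefl cycles

module GraphFacts {n : ℕ} (G : SimpleGraph n) where
  open SimpleGraph G using (adj; irrefl) renaming (sym to adj-comm)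

  adj? : ∀ x y → Dec (Adj G x y)
  adj? x y = adj x y ≟ᴮ true

  adj-sym : ∀ {x y} → Adj G x y → Adj G y x
  adj-sym {x} {y} xy = trans (adj-comm y x) xy

  adj-irrefl : ∀ {x} → ¬ Adj G x x
  adj-irrefl {x} xx = true≢false (trans (sym xx) (irrefl x))

  walk₀ : ∀ {a b} → Walk G a b 0 → a ≡ b
  walk₀ nil = refl

  walk₁ : ∀ {a b} → Walk G a b 1 → Adj G a b
  walk₁ (cons ab nil) = ab

  Apart : (Fin n → Set) → (Fin n → Set) → Set
  Apart A B = ∀ {a b} → A a → B b → (a ≢ b) × ¬ Adj G a b

  apart-sym : ∀ {A B} → Apart A B → Apart B A
  apart-sym apart Bb Aa = let (a≢b , ¬ab) = apart Aa Bb in a≢b ∘ sym , ¬ab ∘ adj-sym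

  apart⇒dist≥2 : ∀ {A B} → Apart A B → SetDist≥ G A B 2
  apart⇒dist≥2 apart 0 _ _ _ Aa Bb w = proj₁ (apart Aa Bb) (walk₀ w)
  apart⇒dist≥2 apart 1 _ _ _ Aa Bb w = proj₂ (apart Aa Bb) (walk₁ w)
  apart⇒dist≥2 apart (suc (suc _)) (s≤s (s≤s ()))

  dist≥2⇒apart : ∀ {A B} → SetDist≥ G A B 2 → Apart A B
  dist≥2⇒apart far {a} {b} Aa Bb =
    (λ a≡b → far 0 (s≤s z≤n) a b Aa Bb (subst (λ c → Walk G a c 0) a≡b nil)) ,
    (λ ab  → far 1 (s≤s (s≤s z≤n)) a b Aa Bb (cons ab nil))

  CommonNeighbour : (Fin n → Set) → (Fin n → Set) → Set
  CommonNeighbour A B =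
    Σ[ a ∈ Fin n ] Σ[ b ∈ Fin n ] Σ[ c ∈ Fin n ] (A a × B b × Adj G a c × Adj G c b)

  dist2-intro : ∀ {A B} → CommonNeighbour A B → Apart A B → SetDist G A B 2
  dist2-intro (a , b , c , Aa , Bb , ac , cb) apart =
    (a , b , Aa , Bb , cons ac (cons cb nil)) , apart⇒dist≥2 apart

  dist2-elim : ∀ {A B} → SetDist G A B 2 → CommonNeighbour A B × Apart A B
  dist2-elim ((a , b , Aa , Bb , cons ac (cons cb nil)) , far) =
    (a , b , _ , Aa , Bb , ac , cb) , dist≥2⇒apart far

  dist1-intro : ∀ {B x z} → ¬ B x → B z → Adj G x z → SetDist G (Single G x) B 1
  dist1-intro {B} {x} x∉B Bz xz = (x , _ , refl , Bz , cons xz nil) , near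
    where
    near : ∀ m → m < 1 → ∀ a b → Single G x a → B b → ¬ Walk G a b m
    near 0 _ _ _ refl Bb w = x∉B (subst B (sym (walk₀ w)) Bb)
    near (suc _) (s≤s ())

  dist1-elim : ∀ {B x} → SetDist G (Single G x) B 1 → Σ[ z ∈ Fin n ] (B z × Adj G x z)
  dist1-elim ((_ , z , refl , Bz , w) , _) = z , Bz , walk₁ w

  module _ {k : ℕ} (e : Fin k → Edge G) where

    Condition-ii : Set
    Condition-ii = ∀ i j → toℕ i < toℕ j → SetDist≥ G (Ends G (e i)) (Ends G (e j)) 2

    Separated : Set
    Separated = ∀ {i j} → i ≢ j → Apart (Ends G (e i)) (Ends G (e j))

    separated⇒ii : Separated → Condition-ii
    separated⇒ii separated i j i<j = apart⇒dist≥2 (separated (<⇒≢ i<j ∘ cong toℕ))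

    ii⇒separated : Condition-ii → Separated
    ii⇒separated ii {i} {j} i≢j with <-cmp (toℕ i) (toℕ j)
    ... | tri< i<j _ _ = dist≥2⇒apart (ii i j i<j)
    ... | tri≈ _ i≡j _ = contradiction (toℕ-injective i≡j) i≢j
    ... | tri> _ _ j<i = apart-sym (dist≥2⇒apart (ii j i j<i))

-- The two matched classes V₁ = part⁻¹(1) and V₂ = part⁻¹(2) of a
-- K₂-partition are named by the two colours.
label : Bool → Fin 3
label true  = suc zero
label false = suc (suc zero)

label≢0 : ∀ b → label b ≢ zero
label≢0 true  ()
label≢0 false ()

label-injective : ∀ {a b} → label a ≡ label b → a ≡ b
label-injective {true}  {true}  _ = refl
label-injective {false} {false} _ = refl

label-surjective : ∀ c → c ≢ zero → Σ Bool λ b → label b ≡ c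
label-surjective zero             c≢0 = contradiction refl c≢0
label-surjective (suc zero)       _   = true  , refl
label-surjective (suc (suc zero)) _   = false , refl

label-cover : ∀ {a b} → a ≢ b → ∀ (i : Fin 2) → (label a ≡ suc i) ⊎ (label b ≡ suc i)
label-cover {true}  {false} _ zero       = inj₁ refl
label-cover {true}  {false} _ (suc zero) = inj₂ refl
label-cover {false} {true}  _ zero       = inj₂ refl
label-cover {false} {true}  _ (suc zero) = inj₁ refl
label-cover {true}  {true}  a≢b _ = contradiction refl a≢b
label-cover {false} {false} a≢b _ = contradiction refl a≢b

suc⇒nonzero : ∀ {r} {c : Fin (suc r)} {i} → c ≡ suc i → c ≢ zero
suc⇒nonzero c≡suc c≡0 = zero≢suc (trans (sym c≡0) c≡suc)

nonzero⇒suc : ∀ {r} (c : Fin (suc r)) → c ≢ zero → Σ (Fin r) λ i → c ≡ suc i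
nonzero⇒suc zero    c≢0 = contradiction refl c≢0
nonzero⇒suc (suc i) _   = i , refl

lookup-injective : ∀ {A : Set} {xs : List A} → Unique xs →
  ∀ {i j} → lookup xs i ≡ lookup xs j → i ≡ j
lookup-injective (_    ∷ _) {zero}  {zero}  _  = refl
lookup-injective (x∉xs ∷ _) {zero}  {suc j} eq = contradiction eq (lookupAll x∉xs (∈-lookup j))
lookup-injective (x∉xs ∷ _) {suc i} {zero}  eq = contradiction (sym eq) (lookupAll x∉xs (∈-lookup i))
lookup-injective (_ ∷ unique) {suc i} {suc j} eq = cong suc (lookup-injective unique eq)

-- By (C) the matched vertices V₁ ∪ V₂ are perfectly
-- matched; the matching edges, listed once each via their smaller end
-- ("leader"), form a zig-zag set.
module AmenableToZigZag {n : ℕ} (G : SimpleGraph n) (part : Fin n → Fin 3)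
  (K : IsKrPartition G 2 part) where
  open GraphFacts G

  condition-A : ∀ x → part x ≡ zero → ∀ (i : Fin 2) → ExactlyOne (λ y → Adj G x y × part y ≡ suc i)
  condition-A = proj₁ K

  condition-B : ∀ (i : Fin 2) x → part x ≡ suc i → ExactlyOne (λ y → Adj G x y × part y ≡ suc i)
  condition-B = proj₁ (proj₂ K)

  condition-C : ∀ x → part x ≢ zero → ExactlyOne (λ y → Adj G x y × part y ≢ zero)
  condition-C = proj₂ (proj₂ K)

  Matched : Fin n → Set
  Matched x = part x ≢ zero

  -- the matched neighbour of a matched vertex; unmatched vertices are fixed
  partner : Fin n → Fin n
  partner x with part x ≟ᶠ zero
  ... | yes _       = x
  ... | no  matched = proj₁ (condition-C x matched)

  partner-spec : ∀ {x} → Matched x →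
    (Adj G x (partner x) × Matched (partner x)) × (∀ z → Adj G x z × Matched z → z ≡ partner x)
  partner-spec {x} matched with part x ≟ᶠ zero
  ... | yes unmatched = contradiction unmatched matched
  ... | no  matched′  = proj₂ (condition-C x matched′)

  partner-adj : ∀ {x} → Matched x → Adj G x (partner x)
  partner-adj = proj₁ ∘ proj₁ ∘ partner-spec

  partner-matched : ∀ {x} → Matched x → Matched (partner x)
  partner-matched = proj₂ ∘ proj₁ ∘ partner-spec

  partner-unique : ∀ {x z} → Matched x → Adj G x z → Matched z → z ≡ partner x
  partner-unique {x} {z} matched xz mz = proj₂ (partner-spec matched) z (xz , mz)

  partner-involutive : ∀ {x} → Matched x → partner (partner x) ≡ x
  partner-involutive m =
    sym (partner-unique (partner-matched m) (adj-sym (partner-adj m)) m)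

  partner-≢ : ∀ {x} → Matched x → partner x ≢ x
  partner-≢ {x} m eq = adj-irrefl (subst (Adj G x) eq (partner-adj m))

  partner-part : ∀ {x} → Matched x → part (partner x) ≡ part x
  partner-part {x} m with nonzero⇒suc (part x) m
  ... | i , x∈Vᵢ with condition-B i x x∈Vᵢ
  ...   | y , (xy , y∈Vᵢ) , _ =
    trans (cong part (sym (partner-unique m xy (suc⇒nonzero y∈Vᵢ))))
          (trans y∈Vᵢ (sym x∈Vᵢ))

  -- an unmatched vertex has exactly one neighbour in each matched class,
  -- so two ends of one class with a common unmatched neighbour coincide
  common-unmatched : ∀ {w a b} → part w ≡ zero → Adj G w a → Adj G w b →
    part a ≡ part b → Matched a → a ≡ b
  common-unmatched {w} {a} {b} w∈V₀ wa wb same ma with nonzero⇒suc (part a) ma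
  ... | i , a∈Vᵢ with condition-A w w∈V₀ i
  ...   | _ , _ , unique = trans (unique a (wa , a∈Vᵢ)) (sym (unique b (wb , trans (sym same) a∈Vᵢ)))

  Leader : Fin n → Set
  Leader x = Matched x × toℕ x < toℕ (partner x)

  leader? : ∀ x → Dec (Leader x)
  leader? x = ¬? (part x ≟ᶠ zero) ×-dec (toℕ x <? toℕ (partner x))

  leaders : List (Fin n)
  leaders = filter leader? (allFin n)

  k : ℕ
  k = length leaders

  leader : Fin k → Fin n
  leader = lookup leaders

  leader-spec : ∀ i → Leader (leader i)
  leader-spec i = proj₂ (∈-filter⁻ leader? {xs = allFin n} (∈-lookup i))

  leader-matched : ∀ i → Matched (leader i)
  leader-matched i = proj₁ (leader-spec i)

  leader-injective : ∀ {i j} → leader i ≡ leader j → i ≡ j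
  leader-injective = lookup-injective (filter⁺ leader? (allFin⁺ n))

  leader-complete : ∀ {x} → Leader x → Σ (Fin k) λ i → leader i ≡ x
  leader-complete {x} lx = indexAny x∈ , sym (lookup-index x∈)
    where
    x∈ : x ∈ leaders
    x∈ = ∈-filter⁺ leader? (∈-allFin x) lx

  leader-pair : ∀ {x} → Leader x → ¬ Leader (partner x)
  leader-pair (m , x<px) (_ , px<ppx) =
    <-asym x<px (subst (λ y → toℕ (partner _) < toℕ y) (partner-involutive m) px<ppx)

  edge : Fin k → Edge G
  edge i = leader i , partner (leader i) , partner-adj (leader-matched i)

  E : Fin k → Fin n → Set
  E i = Ends G (edge i)

  end-matched : ∀ {i w} → E i w → Matched w
  end-matched {i} (inj₁ refl) = leader-matched i
  end-matched {i} (inj₂ refl) = partner-matched (leader-matched i)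

  end-partner : ∀ {i w} → E i w → E i (partner w)
  end-partner      (inj₁ refl) = inj₂ refl
  end-partner {i}  (inj₂ refl) = inj₁ (partner-involutive (leader-matched i))

  end-part : ∀ {i w} → E i w → part w ≡ part (leader i)
  end-part     (inj₁ refl) = refl
  end-part {i} (inj₂ refl) = partner-part (leader-matched i)

  end-leader : ∀ {i w} → E i w → (leader i ≡ w) ⊎ (leader i ≡ partner w)
  end-leader     (inj₁ refl) = inj₁ refl
  end-leader {i} (inj₂ refl) = inj₂ (sym (partner-involutive (leader-matched i)))

  matched-end : ∀ {w} → Matched w → Σ (Fin k) λ i → E i w
  matched-end {w} m with <-cmp (toℕ w) (toℕ (partner w))
  ... | tri< w<pw _ _ = let (i , eq) = leader-complete (m , w<pw) in i , inj₁ (sym eq)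
  ... | tri≈ _ w≡pw _ = contradiction (toℕ-injective (sym w≡pw)) (partner-≢ m)
  ... | tri> _ _ pw<w = let (i , eq) = leader-complete (partner-matched m , pw<ppw) in
                        i , inj₂ (trans (sym (partner-involutive m)) (cong partner (sym eq)))
    where
    pw<ppw : toℕ (partner w) < toℕ (partner (partner w))
    pw<ppw = subst (λ y → toℕ (partner w) < toℕ y) (sym (partner-involutive m)) pw<w

  end-unique : ∀ {i j w} → E i w → E j w → i ≡ j
  end-unique {i} {j} ei ej with end-leader ei | end-leader ej
  ... | inj₁ li≡w  | inj₁ lj≡w  = leader-injective (trans li≡w (sym lj≡w))
  ... | inj₂ li≡pw | inj₂ lj≡pw = leader-injective (trans li≡pw (sym lj≡pw))
  ... | inj₁ refl  | inj₂ lj≡pw =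
    ⊥-elim (leader-pair (leader-spec i) (subst Leader lj≡pw (leader-spec j)))
  ... | inj₂ li≡pw | inj₁ refl  =
    ⊥-elim (leader-pair (leader-spec j) (subst Leader li≡pw (leader-spec i)))

  -- (i): a common neighbour w of both ends would be matched (then it is the
  -- partner itself) or unmatched (then the two ends, lying in one class, coincide)
  condition-i : ∀ i → let (u , v , _) = edge i in ∀ w → ¬ (Adj G u w × Adj G v w)
  condition-i i w (uw , vw) with part w ≟ᶠ zero
  ... | no matched = adj-irrefl (subst (Adj G (partner (leader i)))
                                      (partner-unique (leader-matched i) uw matched) vw)
  ... | yes w∈V₀ = partner-≢ (leader-matched i)
    (sym (common-unmatched w∈V₀ (adj-sym uw) (adj-sym vw)
                           (sym (partner-part (leader-matched i))) (leader-matched i)))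

  -- (ii): ends of different edges are distinct, and adjacent matched
  -- vertices are partners, hence ends of one edge
  separated : Separated edge
  separated {i} {j} i≢j ea eb =
    (λ { refl → i≢j (end-unique ea eb) }) ,
    (λ ab → i≢j (end-unique (subst (E i) (sym (partner-unique (end-matched ea) ab (end-matched eb)))
                                       (end-partner ea)) eb))

  -- (iii): a vertex x outside all edges is unmatched, so by (A) it has one
  -- neighbour in V₁ and one in V₂; these lie on two different edges, and
  -- any edge adjacent to x contains one of them.
  module _ (x : Fin n) (x-outside : ∀ i → ¬ E i x) where

    x∈V₀ : part x ≡ zero
    x∈V₀ with part x ≟ᶠ zero
    ... | yes unmatched = unmatched
    ... | no  matched   = contradiction (proj₂ (matched-end matched)) (x-outside _)

    neighbour : Fin 2 → Fin n
    neighbour c = proj₁ (condition-A x x∈V₀ c)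

    neighbour-adj : ∀ c → Adj G x (neighbour c)
    neighbour-adj c = proj₁ (proj₁ (proj₂ (condition-A x x∈V₀ c)))

    neighbour-class : ∀ c → part (neighbour c) ≡ suc c
    neighbour-class c = proj₂ (proj₁ (proj₂ (condition-A x x∈V₀ c)))

    neighbour-unique : ∀ c z → Adj G x z → part z ≡ suc c → z ≡ neighbour c
    neighbour-unique c z xz z∈V = proj₂ (proj₂ (condition-A x x∈V₀ c)) z (xz , z∈V)

    edge-towards : Fin 2 → Fin k
    edge-towards c = proj₁ (matched-end (suc⇒nonzero (neighbour-class c)))

    edge-towards-end : ∀ c → E (edge-towards c) (neighbour c)
    edge-towards-end c = proj₂ (matched-end (suc⇒nonzero (neighbour-class c)))

    edge-towards-near : ∀ c → SetDist G (Single G x) (E (edge-towards c)) 1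
    edge-towards-near c = dist1-intro (x-outside _) (edge-towards-end c) (neighbour-adj c)

    edge-towards-different : edge-towards zero ≢ edge-towards (suc zero)
    edge-towards-different same with
      trans (sym (neighbour-class zero))
            (trans (end-part (edge-towards-end zero))
                   (trans (cong (part ∘ leader) same)
                          (trans (sym (end-part (edge-towards-end (suc zero))))
                                 (neighbour-class (suc zero)))))
    ... | ()

    edge-towards-class : ∀ {p z} c → E p z → Adj G x z → part z ≡ suc c → p ≡ edge-towards c
    edge-towards-class {z = z} c ez xz z∈V =
      end-unique ez (subst (E _) (sym (neighbour-unique c z xz z∈V)) (edge-towards-end c))

    edge-towards-only : ∀ p → SetDist G (Single G x) (E p) 1 →
      (p ≡ edge-towards zero) ⊎ (p ≡ edge-towards (suc zero))
    edge-towards-only p near with dist1-elim near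
    ... | z , ez , xz with nonzero⇒suc (part z) (end-matched ez)
    ...   | zero     , z∈V = inj₁ (edge-towards-class zero ez xz z∈V)
    ...   | suc zero , z∈V = inj₂ (edge-towards-class (suc zero) ez xz z∈V)

  condition-iii : ∀ x → (∀ i → ¬ E i x) →
    Σ[ j ∈ Fin k ] Σ[ ℓ ∈ Fin k ]
      (j ≢ ℓ × SetDist G (Single G x) (E j) 1 × SetDist G (Single G x) (E ℓ) 1
             × (∀ p → SetDist G (Single G x) (E p) 1 → (p ≡ j) ⊎ (p ≡ ℓ)))
  condition-iii x outside =
    edge-towards x outside zero , edge-towards x outside (suc zero) ,
    edge-towards-different x outside ,
    edge-towards-near x outside zero , edge-towards-near x outside (suc zero) ,
    edge-towards-only x outside

  -- (iv): edges at distance 2 lie in different classes.  Their common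
  -- neighbour is unmatched (a matched one would be the partner of an end,
  -- making the edges adjacent), and an unmatched vertex has only one
  -- neighbour in each class.
  distance2-classes : ∀ {a b} → SetDist G (E a) (E b) 2 → part (leader a) ≢ part (leader b)
  distance2-classes {a} {b} d same with dist2-elim d
  ... | (a′ , b′ , c , ea , eb , a′c , cb′) , apart with part c ≟ᶠ zero
  ...   | no matched =
    proj₂ (apart (subst (E a) (sym (partner-unique (end-matched ea) a′c matched)) (end-partner ea)) eb) cb′
  ...   | yes c∈V₀ =
    proj₁ (apart ea eb) (common-unmatched c∈V₀ (adj-sym a′c) cb′
                           (trans (end-part ea) (trans same (sym (end-part eb)))) (end-matched ea))

  edge-colour : Fin k → Bool
  edge-colour i = proj₁ (label-surjective (part (leader i)) (leader-matched i))

  edge-colour-spec : ∀ i → label (edge-colour i) ≡ part (leader i)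
  edge-colour-spec i = proj₂ (label-surjective (part (leader i)) (leader-matched i))

  condition-iv : CyclesEven (λ a b → SetDist G (E a) (E b) 2)
  condition-iv m s _ _ dist = proper-cycle-even m (edge-colour ∘ s) λ ℓ same →
    distance2-classes (dist ℓ)
      (trans (sym (edge-colour-spec (s ℓ))) (trans (cong label same) (edge-colour-spec (s (next ℓ)))))

  zig-zag : IsZigZagGraph G
  zig-zag = k , edge , condition-i , separated⇒ii edge separated , condition-iii , condition-iv

-- By (ii) the edges form an induced
-- matching, which gives (B) and (C); (A) follows from (iii), (i) and the
-- colouring: an outside vertex touches exactly two edges, which have
-- different colours, and it is adjacent to exactly one end of each.
module ZigZagToAmenable {n : ℕ} (G : SimpleGraph n) (k : ℕ) (e : Fin k → Edge G)
  (Z : IsZigZagSet G k e) where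
  open GraphFacts G

  u v : Fin k → Fin n
  u j = proj₁ (e j)
  v j = proj₁ (proj₂ (e j))

  E : Fin k → Fin n → Set
  E j = Ends G (e j)

  condition-i : ∀ j w → ¬ (Adj G (u j) w × Adj G (v j) w)
  condition-i = proj₁ Z

  condition-ii : Condition-ii e
  condition-ii = proj₁ (proj₂ Z)

  condition-iii : ∀ x → (∀ j → ¬ E j x) →
    Σ[ j ∈ Fin k ] Σ[ ℓ ∈ Fin k ]
      (j ≢ ℓ × SetDist G (Single G x) (E j) 1 × SetDist G (Single G x) (E ℓ) 1
             × (∀ p → SetDist G (Single G x) (E p) 1 → (p ≡ j) ⊎ (p ≡ ℓ)))
  condition-iii = proj₁ (proj₂ (proj₂ Z))

  condition-iv : CyclesEven (λ a b → SetDist G (E a) (E b) 2)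
  condition-iv = proj₂ (proj₂ (proj₂ Z))

  separated : Separated e
  separated = ii⇒separated e condition-ii

  end-unique : ∀ {i j x} → E i x → E j x → i ≡ j
  end-unique {i} {j} ei ej with i ≟ᶠ j
  ... | yes i≡j = i≡j
  ... | no  i≢j = contradiction refl (proj₁ (separated i≢j ei ej))

  adjacent-end-unique : ∀ {j x y z} → E j y → E j z → Adj G x y → Adj G x z → y ≡ z
  adjacent-end-unique     (inj₁ refl) (inj₁ refl) _  _  = refl
  adjacent-end-unique     (inj₂ refl) (inj₂ refl) _  _  = refl
  adjacent-end-unique {j} (inj₁ refl) (inj₂ refl) xu xv =
    ⊥-elim (condition-i j _ (adj-sym xu , adj-sym xv))
  adjacent-end-unique {j} (inj₂ refl) (inj₁ refl) xv xu =
    ⊥-elim (condition-i j _ (adj-sym xu , adj-sym xv))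

  other : ∀ {j x} → E j x → Fin n
  other {j} (inj₁ _) = v j
  other {j} (inj₂ _) = u j

  other-spec : ∀ {j x} (ej : E j x) → Adj G x (other ej) × E j (other ej)
  other-spec {j} (inj₁ refl) = proj₂ (proj₂ (e j)) , inj₂ refl
  other-spec {j} (inj₂ refl) = adj-sym (proj₂ (proj₂ (e j))) , inj₁ refl

  adjacent-ends : ∀ {j x z} (ej : E j x) → E j z → Adj G x z → z ≡ other ej
  adjacent-ends (inj₁ refl) (inj₁ refl) xz = ⊥-elim (adj-irrefl xz)
  adjacent-ends (inj₁ refl) (inj₂ z≡v)  _  = z≡v
  adjacent-ends (inj₂ refl) (inj₁ z≡u)  _  = z≡u
  adjacent-ends (inj₂ refl) (inj₂ refl) xz = ⊥-elim (adj-irrefl xz)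

  Near : Fin k → Fin n → Set
  Near j x = Adj G (u j) x ⊎ Adj G (v j) x

  Touch : Fin k → Fin k → Set
  Touch a b = (a ≢ b) × Σ[ x ∈ Fin n ] (Near a x × Near b x)

  touch? : ∀ a b → Dec (Touch a b)
  touch? a b = ¬? (a ≟ᶠ b) ×-dec any? (λ x → near? a x ×-dec near? b x)
    where
    near? : ∀ j x → Dec (Near j x)
    near? j x = adj? (u j) x ⊎-dec adj? (v j) x

  touch-sym : ∀ {a b} → Touch a b → Touch b a
  touch-sym (a≢b , x , ax , bx) = a≢b ∘ sym , x , bx , ax

  touch-irrefl : ∀ a → ¬ Touch a a
  touch-irrefl a (a≢a , _) = a≢a refl

  near-end : ∀ {j x} → Near j x → Σ[ y ∈ Fin n ] (E j y × Adj G y x)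
  near-end (inj₁ ux) = _ , inj₁ refl , ux
  near-end (inj₂ vx) = _ , inj₂ refl , vx

  end-near : ∀ {j x y} → E j y → Adj G y x → Near j x
  end-near (inj₁ refl) yx = inj₁ yx
  end-near (inj₂ refl) yx = inj₂ yx

  touch-dist2 : ∀ {a b} → Touch a b → SetDist G (E a) (E b) 2
  touch-dist2 (a≢b , x , ax , bx) with near-end ax | near-end bx
  ... | y , ey , yx | z , ez , zx = dist2-intro (y , z , x , ey , ez , yx , adj-sym zx) (separated a≢b)

  -- abstract: only the properness of the colouring matters, and unfolding
  -- its construction would make type checking needlessly expensive
  abstract
    colouring : Σ[ colour ∈ (Fin k → Bool) ] (∀ {a b} → Touch a b → colour a ≢ colour b)
    colouring = bipartite Touch touch? touch-sym touch-irrefl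
      (λ m s long injective steps → condition-iv m s long injective (touch-dist2 ∘ steps))

  colour : Fin k → Bool
  colour = proj₁ colouring

  part : Fin n → Fin 3
  part x with any? (λ j → (x ≟ᶠ u j) ⊎-dec (x ≟ᶠ v j))
  ... | yes (j , _) = label (colour j)
  ... | no  _       = zero

  part-end : ∀ {j x} → E j x → part x ≡ label (colour j)
  part-end {j} {x} ej with any? (λ j → (x ≟ᶠ u j) ⊎-dec (x ≟ᶠ v j))
  ... | yes (j′ , ej′) = cong (label ∘ colour) (end-unique ej′ ej)
  ... | no  ¬end       = contradiction (j , ej) ¬end

  matched-end : ∀ {x} → part x ≢ zero → Σ[ j ∈ Fin k ] E j x
  matched-end {x} x-matched with any? (λ j → (x ≟ᶠ u j) ⊎-dec (x ≟ᶠ v j))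
  ... | yes end = end
  ... | no  _   = contradiction refl x-matched

  other-part : ∀ {j x} (ej : E j x) → part (other ej) ≡ part x
  other-part ej = trans (part-end (proj₂ (other-spec ej))) (sym (part-end ej))

  unmatched-outside : ∀ {x} → part x ≡ zero → ∀ j → ¬ E j x
  unmatched-outside x∈V₀ j ej = label≢0 _ (trans (sym (part-end ej)) x∈V₀)

  matched-neighbour : ∀ {j x z} (ej : E j x) → Adj G x z → part z ≢ zero → z ≡ other ej
  matched-neighbour {j} ej xz z-matched with matched-end z-matched
  ... | q , eq with q ≟ᶠ j
  ...   | yes refl = adjacent-ends ej eq xz
  ...   | no  q≢j  = contradiction (adj-sym xz) (proj₂ (separated q≢j eq ej))

  condition-B : ∀ (i : Fin 2) x → part x ≡ suc i → ExactlyOne (λ y → Adj G x y × part y ≡ suc i)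
  condition-B i x x∈Vᵢ with matched-end (suc⇒nonzero x∈Vᵢ)
  ... | j , ej = other ej , (proj₁ (other-spec ej) , trans (other-part ej) x∈Vᵢ) ,
                 λ z (xz , z∈Vᵢ) → matched-neighbour ej xz (suc⇒nonzero z∈Vᵢ)

  condition-C : ∀ x → part x ≢ zero → ExactlyOne (λ y → Adj G x y × part y ≢ zero)
  condition-C x x-matched with matched-end x-matched
  ... | j , ej = other ej , (proj₁ (other-spec ej) , x-matched ∘ trans (sym (other-part ej))) ,
                 λ z (xz , z-matched) → matched-neighbour ej xz z-matched

  module _ (x : Fin n) (x∈V₀ : part x ≡ zero) (i : Fin 2) where

    NearEdge : Fin k → Set
    NearEdge p = SetDist G (Single G x) (E p) 1

    class-neighbour : ∀ p q → NearEdge p → colour p ≢ colour q → label (colour p) ≡ suc i →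
      (∀ r → NearEdge r → (r ≡ p) ⊎ (r ≡ q)) → ExactlyOne (λ y → Adj G x y × part y ≡ suc i)
    class-neighbour p q near-p p≢q p∈Vᵢ only with dist1-elim near-p
    ... | y , ey , xy = y , (xy , trans (part-end ey) p∈Vᵢ) , unique
      where
      unique : ∀ z → Adj G x z × part z ≡ suc i → z ≡ y
      unique z (xz , z∈Vᵢ) with matched-end (suc⇒nonzero z∈Vᵢ)
      ... | r , er with only r (dist1-intro (unmatched-outside x∈V₀ r) er xz)
      ...   | inj₁ refl = adjacent-end-unique er ey xz xy
      ...   | inj₂ refl =
        contradiction (label-injective (trans p∈Vᵢ (trans (sym z∈Vᵢ) (part-end er)))) p≢q

  near-edge⇒near : ∀ {p x} → SetDist G (Single G x) (E p) 1 → Near p x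
  near-edge⇒near near with dist1-elim near
  ... | y , ey , xy = end-near ey (adj-sym xy)

  condition-A : ∀ x → part x ≡ zero → ∀ (i : Fin 2) → ExactlyOne (λ y → Adj G x y × part y ≡ suc i)
  condition-A x x∈V₀ i with condition-iii x (unmatched-outside x∈V₀)
  ... | j , ℓ , j≢ℓ , near-j , near-ℓ , only = pick (label-cover different i)
    where
    different : colour j ≢ colour ℓ
    different = proj₂ colouring (j≢ℓ , x , near-edge⇒near near-j , near-edge⇒near near-ℓ)

    pick : (label (colour j) ≡ suc i) ⊎ (label (colour ℓ) ≡ suc i) →
           ExactlyOne (λ y → Adj G x y × part y ≡ suc i)
    pick (inj₁ j∈Vᵢ) = class-neighbour x x∈V₀ i j ℓ near-j different j∈Vᵢ only
    pick (inj₂ ℓ∈Vᵢ) = class-neighbour x x∈V₀ i ℓ j near-ℓ (different ∘ sym) ℓ∈Vᵢ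
                         (λ r → swap ∘ only r)

  amenable : Amenable G 2
  amenable = part , condition-A , condition-B , condition-C

-- The two directions.
mainTheorem1 : ∀ (n : ℕ) (G : SimpleGraph n) → 3 ≤ n →
    (Amenable G 2 → IsZigZagGraph G) × (IsZigZagGraph G → Amenable G 2)
mainTheorem1 n G _ =
  (λ { (part , K) → AmenableToZigZag.zig-zag G part K }) ,
  (λ { (k , e , Z) → ZigZagToAmenable.amenable G k e Z })
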